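{- Let $G$ be a cubic graph on $n$ vertices none of whose connected components is isomorphic to $K_4$. Let $D$ be the set of (vertex sets of) induced diamonds in $G$ and $T$ the set of triangles of $G$ that do not belong to a diamond. Then for every partition $\mathcal{P}$ of $V(G)$ into nonempty parts, $d(\mathcal{P})\le\frac54|D|+|T|+\frac14\bigl(n-3|T|-4|D|\bigr)$.
   Context: A cubic graph has all degrees 3. A diamond is $K_4$ minus one edge; a triangle is $K_3$. For $S\subseteq V$, $d(S)=|E(S)|/|S|$ with $E(S)$ the set of edges with both endpoints in $S$; for a partition $\mathcal{P}=\{V_1,\dots,V_k\}$, $d(\mathcal{P})=\sum_i d(V_i)$. -}

module Defs where

open import Data.Bool using (Bool; true; false; _∧_; _∨_; not; if_then_else_)
open import Data.Nat using (ℕ; zero; suc; _≡ᵇ_)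
open import Data.Fin using (Fin; toℕ)
import Data.Fin as F
open import Data.Fin.Properties using (_≟_)
open import Data.List using (List; []; _∷_; _++_; map; length; filter; allFin)
open import Data.Nat.ListAction using (sum)
open import Data.Bool.ListAction using (any)
open import Data.Vec using (Vec; []; _∷_; lookup; tabulate)
open import Data.Product using (Σ; _×_; _,_; ∃)
open import Data.Integer using (+_; -_)
import Data.Integer as ℤ
open import Data.Rational using (ℚ; 0ℚ; _/_; _+_; _-_; _*_; _≤_)
import Data.Rational as ℚ
open import Relation.Nullary.Decidable using (⌊_⌋)
open import Relation.Binary.PropositionalEquality using (_≡_; _≢_)
open import Function using (Surjective)
open import Relation.Nullary using (¬_)

record Graph (n : ℕ) : Set where
  field
    adj    : Fin n → Fin n → Bool
    sym    : ∀ u v → adj u v ≡ adj v u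
    irrefl : ∀ v → adj v v ≡ false
open Graph public

count : ∀ {n} → (Fin n → Bool) → ℕ
count {n} f = length (filter (λ v → f v Data.Bool.≟ true) (allFin n))

degree : ∀ {n} → Graph n → Fin n → ℕ
degree G v = count (adj G v)

Cubic : ∀ {n} → Graph n → Set
Cubic G = ∀ v → degree G v ≡ 3

VSet : ℕ → Set
VSet n = Vec Bool n

_∈ᵇ_ : ∀ {n} → Fin n → VSet n → Bool
v ∈ᵇ S = lookup S v

size : ∀ {n} → VSet n → ℕ
size S = count (λ v → v ∈ᵇ S)

_<ᵇ_ : ∀ {n} → Fin n → Fin n → Bool
u <ᵇ v = ⌊ u F.<? v ⌋

edgesIn : ∀ {n} → Graph n → VSet n → ℕ
edgesIn G S = sum (map (λ u → count (λ v → (u <ᵇ v) ∧ (u ∈ᵇ S) ∧ (v ∈ᵇ S) ∧ adj G u v)) (allFin _))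

_⊆ᵇ_ : ∀ {n} → VSet n → VSet n → Bool
S ⊆ᵇ S' = not (any (λ v → (v ∈ᵇ S) ∧ not (v ∈ᵇ S')) (allFin _))

allSubsets : ∀ n → List (VSet n)
allSubsets zero = [] ∷ []
allSubsets (suc n) = map (false ∷_) (allSubsets n) ++ map (true ∷_) (allSubsets n)

countSets : ∀ {n} → (VSet n → Bool) → ℕ
countSets {n} P = length (filter (λ S → P S Data.Bool.≟ true) (allSubsets n))

-- S induces a diamond (K4 minus an edge): 4 vertices spanning exactly 5 edges
isDiamond : ∀ {n} → Graph n → VSet n → Bool
isDiamond G S = (size S ≡ᵇ 4) ∧ (edgesIn G S ≡ᵇ 5)

isTriangle : ∀ {n} → Graph n → VSet n → Bool
isTriangle G S = (size S ≡ᵇ 3) ∧ (edgesIn G S ≡ᵇ 3)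

isFreeTriangle : ∀ {n} → Graph n → VSet n → Bool
isFreeTriangle {n} G S =
  isTriangle G S ∧ not (any (λ S' → (S ⊆ᵇ S') ∧ isDiamond G S') (allSubsets n))

numDiamonds : ∀ {n} → Graph n → ℕ
numDiamonds G = countSets (isDiamond G)

numFreeTriangles : ∀ {n} → Graph n → ℕ
numFreeTriangles G = countSets (isFreeTriangle G)

-- G has a connected component isomorphic to K4: four distinct pairwise adjacent
-- vertices such that no edge leaves {a,b,c,d} (a complete graph on 4 vertices
-- is connected, so such a closed set is exactly a component, and it is a K4)
HasK4Component : ∀ {n} → Graph n → Set
HasK4Component {n} G =
  Σ (Fin n) λ a → Σ (Fin n) λ b → Σ (Fin n) λ c → Σ (Fin n) λ d →
    (a ≢ b) × (a ≢ c) × (a ≢ d) × (b ≢ c) × (b ≢ d) × (c ≢ d) ×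
    (adj G a b ≡ true) × (adj G a c ≡ true) × (adj G a d ≡ true) ×
    (adj G b c ≡ true) × (adj G b d ≡ true) × (adj G c d ≡ true) ×
    (∀ x y → adj G x y ≡ true →
       (x ≡ a) Data.Sum.⊎ (x ≡ b) Data.Sum.⊎ (x ≡ c) Data.Sum.⊎ (x ≡ d) →
       (y ≡ a) Data.Sum.⊎ (y ≡ b) Data.Sum.⊎ (y ≡ c) Data.Sum.⊎ (y ≡ d))
  where import Data.Sum

-- d(S) = |E(S)| / |S|  (the empty set, which never occurs as a part, gets 0)
density : ∀ {n} → Graph n → VSet n → ℚ
density G S with size S
... | zero  = 0ℚ
... | suc m = (+ edgesIn G S) / suc m

-- a partition of V(G) into k nonempty parts, given by a surjective labelling
-- p : Fin n → Fin k ; the parts are V_i = p⁻¹(i)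
record Partition (n : ℕ) : Set where
  field
    k     : ℕ
    label : Fin n → Fin k
    onto  : Surjective _≡_ _≡_ label
open Partition public

part : ∀ {n} (P : Partition n) → Fin (k P) → VSet n
part P i = tabulate (λ v → ⌊ label P v ≟ i ⌋)

sumℚ : List ℚ → ℚ
sumℚ [] = 0ℚ
sumℚ (x ∷ xs) = x ℚ.+ sumℚ xs

partDensity : ∀ {n} → Graph n → Partition n → ℚ
partDensity G P = sumℚ (map (λ i → density G (part P i)) (allFin (k P)))

ℕtoℚ : ℕ → ℚ
ℕtoℚ m = (+ m) / 1

-- The right-hand side equals (n + |D| + |T|)/4. For a part S with s vertices and e induced
-- edges, cubicity and simplicity give 2e ≤ 3s and 2e + s ≤ s², so 4e ≤ s² once s ≥ 6; among
-- the finitely many smaller cases 4e > s² only for (s, e) = (3,3), (4,5), (5,7), because (4,6)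
-- would be a K₄ component, and there still 4e ≤ s² + s. Summing, d(P) ≤ (n + #dense parts)/4.
-- Every dense part meets a diamond or a triangle outside all diamonds in at least three vertices:
-- the part itself, a diamond containing it, or, for (5,7), what remains after deleting a vertex
-- of inner degree at most 2. Such witnesses have at most four vertices, so disjoint parts have
-- distinct witnesses and there are at most |D| + |T| dense parts.

module Submission where

open import Defs renaming (sym to adj-sym)

open import Data.Bool using (Bool; true; false; _∧_; _∨_; not; T)
import Data.Bool as Bool
open import Data.Bool.Properties using (∧-comm; ∧-zeroʳ; ∧-identityʳ; ∨-zeroʳ; T-≡; T-not-≡; T-∧)
open import Data.Bool.ListAction using (any)
open import Data.Empty using (⊥; ⊥-elim)
open import Data.Fin using (Fin; toℕ; fromℕ<)
import Data.Fin
open import Data.Fin.Properties using (_≟_; all?; toℕ-fromℕ<; toℕ-injective; suc-injective)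
import Data.Integer as ℤ
import Data.Integer.Properties as ℤᴾ
open import Data.List using (List; []; _∷_; map; length; filter; allFin; tabulate)
open import Data.List.Membership.Propositional using (_∈_)
open import Data.List.Membership.Propositional.Properties using (∈-allFin; ∈-++⁺ˡ; ∈-++⁺ʳ; ∈-map⁺)
open import Data.List.Properties using (map-tabulate)
open import Data.List.Relation.Unary.Any using (here; there)
import Data.List.Relation.Unary.Any as Any
open import Data.List.Relation.Unary.Any.Properties using (any⁺; any⁻)
open import Data.Nat using (ℕ; zero; suc; _+_; _*_; _≤_; _<_; z≤n; s≤s; _≤ᵇ_; _≡ᵇ_)
import Data.Nat.Coprimality as Coprimality
open import Data.Nat.ListAction using () renaming (sum to sumᴸ)
open import Data.Nat.Properties hiding (_≟_; suc-injective)
open import Data.Nat.Properties using () renaming (_≟_ to _≟ℕ_)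
open import Data.Nat.Solver using (module +-*-Solver)
open import Data.Product using (_×_; _,_; ∃-syntax; proj₁; proj₂)
open import Data.Rational using (ℚ; _/_)
import Data.Rational as ℚ
import Data.Rational.Properties as ℚᴾ
import Data.Rational.Solver as ℚ-Solver
import Data.Rational.Unnormalised as ℚᵘ
import Data.Rational.Unnormalised.Properties as ℚᵘᴾ
open import Data.Sum using (_⊎_; inj₁; inj₂)
open import Data.Unit using (tt)
open import Data.Vec using (lookup; []) renaming (_∷_ to _∷ᵛ_; tabulate to tabulateᵛ)
open import Data.Vec.Properties using (lookup∘tabulate)
open import Function using (_∘_; id; case_of_)
open import Function.Bundles using (Equivalence)
open import Relation.Binary.PropositionalEquality
open import Relation.Nullary using (¬_; Dec; ¬?; _×-dec_; _⊎-dec_; _→-dec_)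
open import Relation.Nullary.Decidable using (⌊_⌋; yes; no; toWitness)
open import Algebra.Properties.CommutativeSemigroup +-commutativeSemigroup using (interchange)
open import Algebra.Properties.Semiring.Sum +-*-semiring
  using (sum; sum-cong-≗; sum-replicate-zero; ∑-distrib-+; ∑-comm; *-distribˡ-sum; *-distribʳ-sum)

χ : Bool → ℕ
χ true  = 1
χ false = 0

χ≤1 : ∀ b → χ b ≤ 1
χ≤1 true  = ≤-refl
χ≤1 false = z≤n

χ-∧-≤ʳ : ∀ a b → χ (a ∧ b) ≤ χ b
χ-∧-≤ʳ true  b = ≤-refl
χ-∧-≤ʳ false b = z≤n

χ-∧-≤ˡ : ∀ a b → χ (a ∧ b) ≤ χ a
χ-∧-≤ˡ true  b = χ≤1 b
χ-∧-≤ˡ false b = z≤n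

χ-∧≡χʳ⇒ : ∀ a b → χ (a ∧ b) ≡ χ b → b ≡ true → a ≡ true
χ-∧≡χʳ⇒ true  _    _  _ = refl
χ-∧≡χʳ⇒ false true () _

χ-∧≡χˡ⇒ : ∀ a b → χ (a ∧ b) ≡ χ a → a ≡ true → b ≡ true
χ-∧≡χˡ⇒ true true  _  _ = refl
χ-∧≡χˡ⇒ true false () _

∧-not≡false⇒ : ∀ {a b} → a ≡ true → a ∧ not b ≡ false → b ≡ true
∧-not≡false⇒ {true}  {true}  _  _  = refl
∧-not≡false⇒ {true}  {false} _  ()
∧-not≡false⇒ {false}         () _

∧≡true⇒ˡ : ∀ {a b} → a ∧ b ≡ true → a ≡ true
∧≡true⇒ˡ {true} _ = refl

∧≡true⇒ʳ : ∀ {a b} → a ∧ b ≡ true → b ≡ true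
∧≡true⇒ʳ {true} ab = ab

χ-∨-≤ : ∀ a b → χ (a ∨ b) ≤ χ a + χ b
χ-∨-≤ true  b = s≤s z≤n
χ-∨-≤ false b = ≤-refl

+-double-cancel-≤ : ∀ {m n} → m + m ≤ n + n → m ≤ n
+-double-cancel-≤ {m} {n} m+m≤n+n with m ≤? n
... | yes m≤n = m≤n
... | no  m≰n = ⊥-elim (<⇒≱ (+-mono-< (≰⇒> m≰n) (≰⇒> m≰n)) m+m≤n+n)

≤-+-χ-split : ∀ {A B : Set} (a? : Dec A) (b? : Dec B) {x y : ℕ} →
  (⌊ a? ⌋ ≡ false → ⌊ b? ⌋ ≡ false → x ≤ y) → x ≤ y + χ ⌊ a? ⌋ * x + χ ⌊ b? ⌋ * x
≤-+-χ-split (yes _) _       {x} {y} _ = ≤-trans (m≤m+n x 0) (≤-trans (m≤n+m (x + 0) y) (m≤m+n _ _))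
≤-+-χ-split (no _)  (yes _) {x} {y} _ = ≤-trans (m≤m+n x 0) (m≤n+m (x + 0) (y + 0))
≤-+-χ-split (no _)  (no _)  {x} {y} x≤y = ≤-trans (x≤y refl refl) (≤-trans (m≤m+n y 0) (m≤m+n (y + 0) 0))

∑-mono-≤ : ∀ {n} {f g : Fin n → ℕ} → (∀ i → f i ≤ g i) → sum f ≤ sum g
∑-mono-≤ {zero}  f≤g = z≤n
∑-mono-≤ {suc n} f≤g = +-mono-≤ (f≤g Fin.zero) (∑-mono-≤ (f≤g ∘ Fin.suc))

f≤∑f : ∀ {n} (f : Fin n → ℕ) i → f i ≤ sum f
f≤∑f f Fin.zero    = m≤m+n _ _
f≤∑f f (Fin.suc i) = ≤-trans (f≤∑f (f ∘ Fin.suc) i) (m≤n+m _ _)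

∑-mono-≤-≡⇒≗ : ∀ {n} {f g : Fin n → ℕ} → (∀ i → f i ≤ g i) → sum f ≡ sum g → ∀ i → f i ≡ g i
∑-mono-≤-≡⇒≗ {suc n} {f} {g} f≤g ∑f≡∑g = pointwise
  where
  tail≤ : sum (f ∘ Fin.suc) ≤ sum (g ∘ Fin.suc)
  tail≤ = ∑-mono-≤ (f≤g ∘ Fin.suc)
  head≡ : f Fin.zero ≡ g Fin.zero
  head≡ = ≤-antisym (f≤g Fin.zero)
    (+-cancelʳ-≤ _ _ _ (≤-trans (≤-reflexive (sym ∑f≡∑g)) (+-monoʳ-≤ (f Fin.zero) tail≤)))
  tail≡ : sum (f ∘ Fin.suc) ≡ sum (g ∘ Fin.suc)
  tail≡ = +-cancelˡ-≡ (f Fin.zero) _ _ (trans ∑f≡∑g (cong (_+ _) (sym head≡)))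
  pointwise : ∀ i → f i ≡ g i
  pointwise Fin.zero    = head≡
  pointwise (Fin.suc i) = ∑-mono-≤-≡⇒≗ (f≤g ∘ Fin.suc) tail≡ i

∑-<⇒∃< : ∀ {n} {f g : Fin n → ℕ} → sum f < sum g → ∃[ i ] f i < g i
∑-<⇒∃< {suc n} {f} {g} ∑f<∑g with f Fin.zero <? g Fin.zero
... | yes f₀<g₀ = Fin.zero , f₀<g₀
... | no  f₀≮g₀ =
  let i , fᵢ<gᵢ = ∑-<⇒∃< (+-cancelˡ-< (f Fin.zero) _ _ (<-≤-trans ∑f<∑g (+-monoˡ-≤ _ (≮⇒≥ f₀≮g₀))))
  in Fin.suc i , fᵢ<gᵢ

≟-suc : ∀ {n} (i j : Fin n) → ⌊ Fin.suc i ≟ Fin.suc j ⌋ ≡ ⌊ i ≟ j ⌋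
≟-suc i j with i ≟ j
... | yes _ = refl
... | no  _ = refl

≟-sym : ∀ {n} (i j : Fin n) → ⌊ i ≟ j ⌋ ≡ ⌊ j ≟ i ⌋
≟-sym i j with i ≟ j | j ≟ i
... | yes _    | yes _    = refl
... | no  _    | no  _    = refl
... | yes refl | no  i≢i  = ⊥-elim (i≢i refl)
... | no  i≢i  | yes refl = ⊥-elim (i≢i refl)

∑-pick : ∀ {n} (j : Fin n) (g : Fin n → ℕ) → sum (λ i → χ ⌊ i ≟ j ⌋ * g i) ≡ g j
∑-pick {suc n} Fin.zero g = begin
  g Fin.zero + 0 + sum (λ i → 0 * g (Fin.suc i)) ≡⟨ cong (g Fin.zero + 0 +_) (sum-replicate-zero n) ⟩
  g Fin.zero + 0 + 0                             ≡⟨ cong (_+ 0) (+-identityʳ _) ⟩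
  g Fin.zero + 0                                 ≡⟨ +-identityʳ _ ⟩
  g Fin.zero                                     ∎
  where open ≡-Reasoning
∑-pick {suc n} (Fin.suc j) g = trans
  (sum-cong-≗ (λ i → cong (λ b → χ b * g (Fin.suc i)) (≟-suc i j)))
  (∑-pick j (g ∘ Fin.suc))

∑χ-false : ∀ {n} (p : Fin n → Bool) → (∀ i → p i ≡ false) → sum (χ ∘ p) ≡ 0
∑χ-false {zero}  p all-false = refl
∑χ-false {suc n} p all-false rewrite all-false Fin.zero = ∑χ-false (p ∘ Fin.suc) (all-false ∘ Fin.suc)

∑χ-≤1 : ∀ {n} (p : Fin n → Bool) → (∀ i j → p i ≡ true → p j ≡ true → i ≡ j) → sum (χ ∘ p) ≤ 1
∑χ-≤1 {zero}  p unique = z≤n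
∑χ-≤1 {suc n} p unique with p Fin.zero in p₀
... | false = ∑χ-≤1 (p ∘ Fin.suc) (λ i j pᵢ pⱼ → suc-injective (unique _ _ pᵢ pⱼ))
... | true  = ≤-reflexive (cong suc (∑χ-false (p ∘ Fin.suc) tail-false))
  where
  tail-false : ∀ i → p (Fin.suc i) ≡ false
  tail-false i with p (Fin.suc i) in pᵢ
  ... | false = refl
  ... | true  with unique _ _ p₀ pᵢ
  ... | ()

sumᴸ-tabulate : ∀ {n} (f : Fin n → ℕ) → sumᴸ (tabulate f) ≡ sum f
sumᴸ-tabulate {zero}  f = refl
sumᴸ-tabulate {suc n} f = cong (f Fin.zero +_) (sumᴸ-tabulate (f ∘ Fin.suc))

sumᴸ-allFin : ∀ {n} (f : Fin n → ℕ) → sumᴸ (map f (allFin n)) ≡ sum f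
sumᴸ-allFin f = trans (cong sumᴸ (map-tabulate id f)) (sumᴸ-tabulate f)

length-filter≡sumᴸχ : ∀ {A : Set} (p : A → Bool) xs →
  length (filter (λ x → p x Bool.≟ true) xs) ≡ sumᴸ (map (χ ∘ p) xs)
length-filter≡sumᴸχ p []       = refl
length-filter≡sumᴸχ p (x ∷ xs) with p x
... | true  = cong suc (length-filter≡sumᴸχ p xs)
... | false = length-filter≡sumᴸχ p xs

count≡∑χ : ∀ {n} (p : Fin n → Bool) → count p ≡ sum (χ ∘ p)
count≡∑χ {n} p = trans (length-filter≡sumᴸχ p (allFin n)) (sumᴸ-allFin (χ ∘ p))

module _ {A : Set} where

  sumᴸ-mono-≤ : ∀ (xs : List A) {f g : A → ℕ} → (∀ x → f x ≤ g x) → sumᴸ (map f xs) ≤ sumᴸ (map g xs)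
  sumᴸ-mono-≤ []       f≤g = z≤n
  sumᴸ-mono-≤ (x ∷ xs) f≤g = +-mono-≤ (f≤g x) (sumᴸ-mono-≤ xs f≤g)

  sumᴸ-distrib-+ : ∀ (xs : List A) (f g : A → ℕ) →
    sumᴸ (map (λ x → f x + g x) xs) ≡ sumᴸ (map f xs) + sumᴸ (map g xs)
  sumᴸ-distrib-+ []       f g = refl
  sumᴸ-distrib-+ (x ∷ xs) f g = trans (cong (f x + g x +_) (sumᴸ-distrib-+ xs f g))
    (interchange (f x) (g x) _ _)

  ∈⇒≤sumᴸ : ∀ {x} {xs : List A} (f : A → ℕ) → x ∈ xs → f x ≤ sumᴸ (map f xs)
  ∈⇒≤sumᴸ f (here refl) = m≤m+n _ _
  ∈⇒≤sumᴸ f (there x∈xs) = ≤-trans (∈⇒≤sumᴸ f x∈xs) (m≤n+m _ _)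

  ∑-sumᴸ-comm : ∀ {n} (xs : List A) (f : Fin n → A → ℕ) →
    sum (λ i → sumᴸ (map (f i) xs)) ≡ sumᴸ (map (λ x → sum (λ i → f i x)) xs)
  ∑-sumᴸ-comm {n} []       f = sum-replicate-zero n
  ∑-sumᴸ-comm (x ∷ xs) f = trans (∑-distrib-+ (λ i → f i x) _) (cong (_ +_) (∑-sumᴸ-comm xs f))

∑χ-≤-witnesses : ∀ {A : Set} {k} (xs : List A) (P : Fin k → Bool) (Q : A → Bool) (R : Fin k → A → Bool) →
  (∀ i → P i ≡ true → ∃[ x ] x ∈ xs × R i x ≡ true) →
  (∀ x i → R i x ≡ true → Q x ≡ true) →
  (∀ x i j → R i x ≡ true → R j x ≡ true → i ≡ j) →
  sum (χ ∘ P) ≤ sumᴸ (map (χ ∘ Q) xs)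
∑χ-≤-witnesses xs P Q R witness R⇒Q R-unique = begin
  sum (χ ∘ P)                                   ≤⟨ ∑-mono-≤ covered ⟩
  sum (λ i → sumᴸ (map (χ ∘ R i) xs))           ≡⟨ ∑-sumᴸ-comm xs (λ i → χ ∘ R i) ⟩
  sumᴸ (map (λ x → sum (λ i → χ (R i x))) xs)   ≤⟨ sumᴸ-mono-≤ xs witnessed-once ⟩
  sumᴸ (map (χ ∘ Q) xs)                         ∎
  where
  open ≤-Reasoning
  covered : ∀ i → χ (P i) ≤ sumᴸ (map (χ ∘ R i) xs)
  covered i with P i in Pᵢ
  ... | false = z≤n
  ... | true  = let x , x∈xs , Rᵢx = witness i Pᵢ in
    ≤-trans (≤-reflexive (cong χ (sym Rᵢx))) (∈⇒≤sumᴸ (χ ∘ R i) x∈xs)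
  witnessed-once : ∀ x → sum (λ i → χ (R i x)) ≤ χ (Q x)
  witnessed-once x with Q x in Qx
  ... | true  = ∑χ-≤1 (λ i → R i x) (R-unique x)
  ... | false = ≤-reflexive (∑χ-false (λ i → R i x) not-witness)
    where
    not-witness : ∀ i → R i x ≡ false
    not-witness i with R i x in Rᵢx
    ... | false = refl
    ... | true  with trans (sym (R⇒Q x i Rᵢx)) Qx
    ... | ()

card : ∀ {n} → (Fin n → Bool) → ℕ
card p = sum (χ ∘ p)

size≡card : ∀ {n} (S : VSet n) → size S ≡ card (lookup S)
size≡card S = count≡∑χ (lookup S)

_─_ : ∀ {n} → (Fin n → Bool) → Fin n → Fin n → Bool
(p ─ a) v = p v ∧ not ⌊ v ≟ a ⌋

infixl 6 _─_

module _ {n : ℕ} (p : Fin n → Bool) where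

  ─-member : ∀ a v → (p ─ a) v ≡ true → p v ≡ true × v ≢ a
  ─-member a v pv with p v | v ≟ a
  ... | true | no v≢a = refl , v≢a

  ─-keep : ∀ a v → p v ≡ true → v ≢ a → (p ─ a) v ≡ true
  ─-keep a v pv v≢a with v ≟ a
  ... | yes v≡a = ⊥-elim (v≢a v≡a)
  ... | no  _   = trans (∧-identityʳ (p v)) pv

  ─-≢ : ∀ a v → ⌊ v ≟ a ⌋ ≡ false → (p ─ a) v ≡ p v
  ─-≢ a v v≢a = trans (cong (λ b → p v ∧ not b) v≢a) (∧-identityʳ (p v))

  card-─ : ∀ a → card p ≡ card (p ─ a) + χ (p a)
  card-─ a = trans (sum-cong-≗ {n} split) (trans (∑-distrib-+ {n} _ _) (cong (card (p ─ a) +_) (∑-pick a (χ ∘ p))))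
    where
    split : ∀ v → χ (p v) ≡ χ ((p ─ a) v) + χ ⌊ v ≟ a ⌋ * χ (p v)
    split v with p v | v ≟ a
    ... | true  | yes _ = refl
    ... | true  | no  _ = refl
    ... | false | yes _ = refl
    ... | false | no  _ = refl

  card≡0⇒∅ : card p ≡ 0 → ∀ v → p v ≡ false
  card≡0⇒∅ card≡0 v with p v in pv
  ... | false = refl
  ... | true  with ≤-trans (≤-reflexive (cong χ (sym pv))) (≤-trans (f≤∑f (χ ∘ p) v) (≤-reflexive card≡0))
  ... | ()

  card≡suc⇒∃ : ∀ m → card p ≡ suc m → ∃[ a ] p a ≡ true × card (p ─ a) ≡ m
  card≡suc⇒∃ m card≡1+m = a , pa , +-cancelʳ-≡ 1 _ _ (begin
    card (p ─ a) + 1     ≡⟨ cong (λ b → card (p ─ a) + χ b) pa ⟨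
    card (p ─ a) + χ (p a) ≡⟨ card-─ a ⟨
    card p               ≡⟨ card≡1+m ⟩
    suc m                ≡⟨ +-comm 1 m ⟩
    m + 1                ∎)
    where
    open ≡-Reasoning
    nonempty : sum {n} (λ _ → 0) < card p
    nonempty = subst₂ _<_ (sym (sum-replicate-zero n)) (sym card≡1+m) (s≤s (z≤n {m}))
    a : Fin n
    a = proj₁ (∑-<⇒∃< {n} {λ _ → 0} {χ ∘ p} nonempty)
    pa : p a ≡ true
    pa with p a | proj₂ (∑-<⇒∃< {n} {λ _ → 0} {χ ∘ p} nonempty)
    ... | true  | _  = refl

_∩_ : ∀ {n} → (Fin n → Bool) → (Fin n → Bool) → Fin n → Bool
(p ∩ q) v = p v ∧ q v

card-cong : ∀ {n} {p q : Fin n → Bool} → (∀ v → p v ≡ q v) → card p ≡ card q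
card-cong {n} p≗q = sum-cong-≗ {n} (cong χ ∘ p≗q)

card-∩-disjoint : ∀ {n} (p q r : Fin n → Bool) → (∀ v → q v ≡ true → r v ≡ true → ⊥) →
  card (p ∩ q) + card (p ∩ r) ≤ card p
card-∩-disjoint {n} p q r disjoint =
  subst (_≤ card p) (∑-distrib-+ {n} _ _) (∑-mono-≤ pointwise)
  where
  pointwise : ∀ v → χ (p v ∧ q v) + χ (p v ∧ r v) ≤ χ (p v)
  pointwise v with p v | q v in qv | r v in rv
  ... | false | _     | _     = z≤n
  ... | true  | false | b     = χ≤1 b
  ... | true  | true  | false = ≤-refl
  ... | true  | true  | true  = ⊥-elim (disjoint v qv rv)

∑-1 : ∀ n → sum {n} (λ _ → 1) ≡ n
∑-1 zero    = refl
∑-1 (suc n) = cong suc (∑-1 n)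

card-∩-comm : ∀ {n} (p q : Fin n → Bool) → card (p ∩ q) ≡ card (q ∩ p)
card-∩-comm p q = card-cong λ v → ∧-comm (p v) (q v)

⊆⇒card-∩ : ∀ {n} (p q : Fin n → Bool) → (∀ v → p v ≡ true → q v ≡ true) → card (q ∩ p) ≡ card p
⊆⇒card-∩ p q p⊆q = card-cong pointwise
  where
  pointwise : ∀ v → q v ∧ p v ≡ p v
  pointwise v with p v in pv
  ... | false = ∧-zeroʳ (q v)
  ... | true  = trans (∧-identityʳ (q v)) (p⊆q v pv)

OneOf4 : ∀ {n} → Fin n → Fin n → Fin n → Fin n → Fin n → Set
OneOf4 v a b c d = v ≡ a ⊎ v ≡ b ⊎ v ≡ c ⊎ v ≡ d

record FourElements {n} (p : Fin n → Bool) : Set where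
  field
    a b c d : Fin n
    b≢a : b ≢ a
    c≢a : c ≢ a
    c≢b : c ≢ b
    d≢a : d ≢ a
    d≢b : d ≢ b
    d≢c : d ≢ c
    ∈⇒oneOf : ∀ v → p v ≡ true → OneOf4 v a b c d
    oneOf⇒∈ : ∀ v → OneOf4 v a b c d → p v ≡ true

card≡4⇒FourElements : ∀ {n} (p : Fin n → Bool) → card p ≡ 4 → FourElements p
card≡4⇒FourElements p card≡4 with card≡suc⇒∃ p 3 card≡4
... | a , pa , card₃ with card≡suc⇒∃ (p ─ a) 2 card₃
... | b , p₁b , card₂ with card≡suc⇒∃ (p ─ a ─ b) 1 card₂
... | c , p₂c , card₁ with card≡suc⇒∃ (p ─ a ─ b ─ c) 0 card₁
... | d , p₃d , card₀ = record
  { a = a ; b = b ; c = c ; d = d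
  ; b≢a = proj₂ (─-member p a b p₁b)
  ; c≢a = proj₂ (─-member p a c p₁c)
  ; c≢b = proj₂ (─-member (p ─ a) b c p₂c)
  ; d≢a = proj₂ (─-member p a d p₁d)
  ; d≢b = proj₂ (─-member (p ─ a) b d p₂d)
  ; d≢c = proj₂ (─-member (p ─ a ─ b) c d p₃d)
  ; ∈⇒oneOf = ∈⇒oneOf
  ; oneOf⇒∈ = oneOf⇒∈
  }
  where
  p₁c = proj₁ (─-member (p ─ a) b c p₂c)
  p₂d = proj₁ (─-member (p ─ a ─ b) c d p₃d)
  p₁d = proj₁ (─-member (p ─ a) b d p₂d)
  ∈⇒oneOf : ∀ v → p v ≡ true → OneOf4 v a b c d
  ∈⇒oneOf v pv with v ≟ a | v ≟ b | v ≟ c | v ≟ d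
  ... | yes v≡a | _       | _       | _       = inj₁ v≡a
  ... | no _    | yes v≡b | _       | _       = inj₂ (inj₁ v≡b)
  ... | no _    | no _    | yes v≡c | _       = inj₂ (inj₂ (inj₁ v≡c))
  ... | no _    | no _    | no _    | yes v≡d = inj₂ (inj₂ (inj₂ v≡d))
  ... | no v≢a  | no v≢b  | no v≢c  | no v≢d
    with trans (sym (card≡0⇒∅ (p ─ a ─ b ─ c ─ d) card₀ v))
           (─-keep (p ─ a ─ b ─ c) d v (─-keep (p ─ a ─ b) c v (─-keep (p ─ a) b v (─-keep p a v pv v≢a) v≢b) v≢c) v≢d)
  ... | ()
  oneOf⇒∈ : ∀ v → OneOf4 v a b c d → p v ≡ true
  oneOf⇒∈ v (inj₁ refl)                = pa
  oneOf⇒∈ v (inj₂ (inj₁ refl))         = proj₁ (─-member p a b p₁b)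
  oneOf⇒∈ v (inj₂ (inj₂ (inj₁ refl)))  = proj₁ (─-member p a c p₁c)
  oneOf⇒∈ v (inj₂ (inj₂ (inj₂ refl)))  = proj₁ (─-member p a d p₁d)

-- Edges of induced subgraphs

module _ {n : ℕ} (G : Graph n) where

  induced : (Fin n → Bool) → Fin n → Fin n → Bool
  induced p u v = p u ∧ (p v ∧ adj G u v)

  edges : (Fin n → Bool) → ℕ
  edges p = sum λ u → sum λ v → χ ((u <ᵇ v) ∧ induced p u v)

  innerDegree : (Fin n → Bool) → Fin n → ℕ
  innerDegree p u = sum λ v → χ (induced p u v)

  neighboursIn : (Fin n → Bool) → Fin n → ℕ
  neighboursIn p u = sum λ v → χ (p v ∧ adj G u v)

  edgesIn≡edges : ∀ (S : VSet n) → edgesIn G S ≡ edges (lookup S)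
  edgesIn≡edges S = trans (sumᴸ-allFin {n} _)
    (sum-cong-≗ {n} λ u → count≡∑χ (λ v → (u <ᵇ v) ∧ induced (lookup S) u v))

  edges-cong : ∀ {p q : Fin n → Bool} → (∀ v → p v ≡ q v) → edges p ≡ edges q
  edges-cong p≗q = sum-cong-≗ {n} λ u → sum-cong-≗ {n} λ v →
    cong₂ (λ a b → χ ((u <ᵇ v) ∧ a ∧ (b ∧ adj G u v))) (p≗q u) (p≗q v)

  induced-sym : ∀ (p : Fin n → Bool) u v → induced p u v ≡ induced p v u
  induced-sym p u v rewrite adj-sym G u v with p u | p v
  ... | true  | true  = refl
  ... | true  | false = refl
  ... | false | true  = refl
  ... | false | false = refl

  induced-irrefl : ∀ (p : Fin n → Bool) u → induced p u u ≡ false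
  induced-irrefl p u rewrite irrefl G u = trans (cong (p u ∧_) (∧-zeroʳ (p u))) (∧-zeroʳ (p u))

  handshake : ∀ (p : Fin n → Bool) → sum (innerDegree p) ≡ edges p + edges p
  handshake p = begin
    sum (λ u → sum λ v → χ (induced p u v))                          ≡⟨ sum-cong-≗ {n} (λ u → sum-cong-≗ {n} (split u)) ⟩
    sum (λ u → sum λ v → χ (u <ᵇ v ∧ induced p u v) + χ (v <ᵇ u ∧ induced p u v))
                                                                     ≡⟨ sum-cong-≗ {n} (λ u → ∑-distrib-+ {n} _ _) ⟩
    sum (λ u → sum (λ v → χ (u <ᵇ v ∧ induced p u v)) + sum (λ v → χ (v <ᵇ u ∧ induced p u v)))
                                                                     ≡⟨ ∑-distrib-+ {n} _ _ ⟩
    edges p + sum (λ u → sum λ v → χ (v <ᵇ u ∧ induced p u v))       ≡⟨ cong (edges p +_) (∑-comm {n} {n} _) ⟩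
    edges p + sum (λ v → sum λ u → χ (v <ᵇ u ∧ induced p u v))       ≡⟨ cong (edges p +_) (sum-cong-≗ {n} λ v → sum-cong-≗ {n} λ u →
                                                                          cong (λ b → χ (v <ᵇ u ∧ b)) (induced-sym p u v)) ⟩
    edges p + edges p                                                ∎
    where
    open ≡-Reasoning
    split : ∀ u v → χ (induced p u v) ≡ χ (u <ᵇ v ∧ induced p u v) + χ (v <ᵇ u ∧ induced p u v)
    split u v with u Data.Fin.<? v | v Data.Fin.<? u
    ... | yes u<v | yes v<u = ⊥-elim (<-asym u<v v<u)
    ... | yes _   | no  _   = sym (+-identityʳ _)
    ... | no  _   | yes _   = refl
    ... | no  u≮v | no  v≮u
      rewrite toℕ-injective (≤-antisym (≮⇒≥ v≮u) (≮⇒≥ u≮v)) | induced-irrefl p v = refl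

  degree≡∑χ : ∀ u → degree G u ≡ sum (χ ∘ adj G u)
  degree≡∑χ u = count≡∑χ (adj G u)

  innerDegree-member : ∀ (p : Fin n → Bool) u → p u ≡ true → innerDegree p u ≡ neighboursIn p u
  innerDegree-member p u pu rewrite pu = refl

  neighbours-≤-degree : ∀ (p : Fin n → Bool) u → neighboursIn p u ≤ degree G u
  neighbours-≤-degree p u =
    ≤-trans (∑-mono-≤ (λ v → χ-∧-≤ʳ (p v) (adj G u v))) (≤-reflexive (sym (degree≡∑χ u)))

  neighbour-or-self≤member : ∀ (p : Fin n → Bool) u v → χ (p v ∧ adj G u v) + χ ⌊ v ≟ u ⌋ * χ (p v) ≤ χ (p v)
  neighbour-or-self≤member p u v with v ≟ u
  ... | yes refl rewrite irrefl G u | ∧-zeroʳ (p u) = ≤-reflexive (+-identityʳ _)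
  ... | no  _    rewrite +-identityʳ (χ (p v ∧ adj G u v)) = χ-∧-≤ˡ (p v) (adj G u v)

  ∑neighbour-or-self : ∀ (p : Fin n → Bool) u →
    sum (λ v → χ (p v ∧ adj G u v) + χ ⌊ v ≟ u ⌋ * χ (p v)) ≡ neighboursIn p u + χ (p u)
  ∑neighbour-or-self p u = trans (∑-distrib-+ {n} _ _) (cong (neighboursIn p u +_) (∑-pick u (χ ∘ p)))

  neighbours+self≤card : ∀ (p : Fin n → Bool) u → neighboursIn p u + χ (p u) ≤ card p
  neighbours+self≤card p u = subst (_≤ card p) (∑neighbour-or-self p u) (∑-mono-≤ (neighbour-or-self≤member p u))

  edges+edges+card≤card² : ∀ (p : Fin n → Bool) → edges p + edges p + card p ≤ card p * card p
  edges+edges+card≤card² p = begin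
    edges p + edges p + card p                    ≡⟨ cong (_+ card p) (handshake p) ⟨
    sum (innerDegree p) + card p                  ≡⟨ ∑-distrib-+ {n} _ _ ⟨
    sum (λ u → innerDegree p u + χ (p u))         ≤⟨ ∑-mono-≤ pointwise ⟩
    sum (λ u → χ (p u) * card p)                  ≡⟨ *-distribʳ-sum (card p) (χ ∘ p) ⟨
    card p * card p                               ∎
    where
    open ≤-Reasoning
    pointwise : ∀ u → innerDegree p u + χ (p u) ≤ χ (p u) * card p
    pointwise u with p u in pu
    ... | false = ≤-reflexive (trans (+-identityʳ _) (sum-replicate-zero n))
    ... | true  = ≤-trans (subst (λ b → neighboursIn p u + χ b ≤ card p) pu (neighbours+self≤card p u))
                          (≤-reflexive (sym (+-identityʳ (card p))))

  module _ (cubic : Cubic G) where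

    innerDegree≤3 : ∀ (p : Fin n → Bool) u → innerDegree p u ≤ 3 * χ (p u)
    innerDegree≤3 p u with p u in pu
    ... | false = ≤-reflexive (sum-replicate-zero n)
    ... | true  = ≤-trans (neighbours-≤-degree p u) (≤-reflexive (cubic u))

    ∑innerDegree≤3card : ∀ (p : Fin n → Bool) → sum (innerDegree p) ≤ 3 * card p
    ∑innerDegree≤3card p =
      ≤-trans (∑-mono-≤ (innerDegree≤3 p)) (≤-reflexive (sym (*-distribˡ-sum 3 (χ ∘ p))))

    edges+edges≤3card : ∀ (p : Fin n → Bool) → edges p + edges p ≤ 3 * card p
    edges+edges≤3card p = subst (_≤ 3 * card p) (handshake p) (∑innerDegree≤3card p)

    K4-component : ∀ (p : Fin n → Bool) → card p ≡ 4 → edges p ≡ 6 → HasK4Component G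
    K4-component p card≡4 edges≡6 =
      a , b , c , d , ≢-sym b≢a , ≢-sym c≢a , ≢-sym d≢a , ≢-sym c≢b , ≢-sym d≢b , ≢-sym d≢c ,
      adjacent a b pa pb b≢a , adjacent a c pa pc c≢a , adjacent a d pa pd d≢a ,
      adjacent b c pb pc c≢b , adjacent b d pb pd d≢b , adjacent c d pc pd d≢c ,
      λ x y xy x∈ → ∈⇒oneOf y (closed x y (oneOf⇒∈ x x∈) xy)
      where
      open FourElements (card≡4⇒FourElements p card≡4)
      pa = oneOf⇒∈ a (inj₁ refl)
      pb = oneOf⇒∈ b (inj₂ (inj₁ refl))
      pc = oneOf⇒∈ c (inj₂ (inj₂ (inj₁ refl)))
      pd = oneOf⇒∈ d (inj₂ (inj₂ (inj₂ refl)))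
      innerDegree≡3 : ∀ u → innerDegree p u ≡ 3 * χ (p u)
      innerDegree≡3 = ∑-mono-≤-≡⇒≗ (innerDegree≤3 p) (begin
        sum (innerDegree p)       ≡⟨ handshake p ⟩
        edges p + edges p         ≡⟨ cong₂ _+_ edges≡6 edges≡6 ⟩
        3 * 4                     ≡⟨ cong (3 *_) card≡4 ⟨
        3 * card p                ≡⟨ *-distribˡ-sum 3 (χ ∘ p) ⟩
        sum (λ u → 3 * χ (p u))   ∎)
        where open ≡-Reasoning
      neighbours≡3 : ∀ u → p u ≡ true → neighboursIn p u ≡ 3
      neighbours≡3 u pu = trans (sym (innerDegree-member p u pu)) (trans (innerDegree≡3 u) (cong (λ b → 3 * χ b) pu))
      closed : ∀ u v → p u ≡ true → adj G u v ≡ true → p v ≡ true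
      closed u v pu uv = χ-∧≡χʳ⇒ (p v) (adj G u v)
        (∑-mono-≤-≡⇒≗ (λ w → χ-∧-≤ʳ (p w) (adj G u w))
          (trans (neighbours≡3 u pu) (sym (trans (sym (degree≡∑χ u)) (cubic u)))) v)
        uv
      adjacent : ∀ u v → p u ≡ true → p v ≡ true → v ≢ u → adj G u v ≡ true
      adjacent u v pu pv v≢u = from-tight (v ≟ u)
        (∑-mono-≤-≡⇒≗ (neighbour-or-self≤member p u)
          (trans (∑neighbour-or-self p u) (trans (cong₂ _+_ (neighbours≡3 u pu) (cong χ pu)) (sym card≡4))) v)
        where
        from-tight : (v≟u : Dec (v ≡ u)) → χ (p v ∧ adj G u v) + χ ⌊ v≟u ⌋ * χ (p v) ≡ χ (p v) → adj G u v ≡ true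
        from-tight (yes v≡u) _     = ⊥-elim (v≢u v≡u)
        from-tight (no  _)   tight = χ-∧≡χˡ⇒ (p v) (adj G u v) (trans (sym (+-identityʳ _)) tight) pv

    ∑innerDegree-─ : ∀ (p : Fin n → Bool) w →
      sum (innerDegree p) ≤ sum (innerDegree (p ─ w)) + innerDegree p w + innerDegree p w
    ∑innerDegree-─ p w = begin
      sum (λ u → sum λ v → χ (induced p u v))
        ≤⟨ ∑-mono-≤ (λ u → ∑-mono-≤ (pointwise u)) ⟩
      sum (λ u → sum λ v → χ (induced (p ─ w) u v) + χ ⌊ u ≟ w ⌋ * χ (induced p u v) + χ ⌊ v ≟ w ⌋ * χ (induced p u v))
        ≡⟨ sum-cong-≗ {n} (λ u → trans (∑-distrib-+ {n} _ _)
             (cong₂ _+_ (trans (∑-distrib-+ {n} _ _) (cong (innerDegree (p ─ w) u +_)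
                           (sym (*-distribˡ-sum {n} (χ ⌊ u ≟ w ⌋) (χ ∘ induced p u)))))
                        (∑-pick w (χ ∘ induced p u)))) ⟩
      sum (λ u → innerDegree (p ─ w) u + χ ⌊ u ≟ w ⌋ * innerDegree p u + χ (induced p u w))
        ≡⟨ trans (∑-distrib-+ {n} _ _) (cong₂ _+_
             (trans (∑-distrib-+ {n} _ _) (cong (sum (innerDegree (p ─ w)) +_) (∑-pick w (innerDegree p))))
             (sum-cong-≗ {n} (λ u → cong χ (induced-sym p u w)))) ⟩
      sum (innerDegree (p ─ w)) + innerDegree p w + innerDegree p w ∎
      where
      open ≤-Reasoning
      pointwise : ∀ u v → χ (induced p u v) ≤
        χ (induced (p ─ w) u v) + χ ⌊ u ≟ w ⌋ * χ (induced p u v) + χ ⌊ v ≟ w ⌋ * χ (induced p u v)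
      pointwise u v = ≤-+-χ-split (u ≟ w) (v ≟ w) λ u≢w v≢w → ≤-reflexive (cong χ (cong₂ (λ a b → a ∧ (b ∧ adj G u v))
        (sym (─-≢ p w u u≢w)) (sym (─-≢ p w v v≢w))))

    card≡5∧edges≡7⇒diamond : ¬ HasK4Component G → ∀ (p : Fin n → Bool) → card p ≡ 5 → edges p ≡ 7 →
      ∃[ w ] p w ≡ true × card (p ─ w) ≡ 4 × edges (p ─ w) ≡ 5
    card≡5∧edges≡7⇒diamond noK4 p card≡5 edges≡7 = w , pw , card-q≡4 , edges-q≡5
      where
      -- inner degrees sum to 14 < 3 · 5, so some vertex of p has at most two neighbours in p
      deficient : sum (innerDegree p) < sum (λ u → 3 * χ (p u))
      deficient = subst₂ _<_ (sym (trans (handshake p) (cong₂ _+_ edges≡7 edges≡7)))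
        (trans (cong (3 *_) (sym card≡5)) (*-distribˡ-sum 3 (χ ∘ p))) ≤-refl
      deficient-vertex : ∃[ u ] innerDegree p u < 3 * χ (p u)
      deficient-vertex = ∑-<⇒∃< {n} {innerDegree p} {λ u → 3 * χ (p u)} deficient
      w = proj₁ deficient-vertex
      low : p w ≡ true × innerDegree p w ≤ 2
      low with p w | proj₂ deficient-vertex
      ... | true | s≤s lt = refl , lt
      pw = proj₁ low
      q = p ─ w
      card-q≡4 : card q ≡ 4
      card-q≡4 = +-cancelʳ-≡ 1 _ _ (trans (cong (λ b → card q + χ b) (sym pw)) (trans (sym (card-─ p w)) card≡5))
      5≤edges-q : 5 ≤ edges q
      5≤edges-q = +-double-cancel-≤ (+-cancelʳ-≤ 4 10 (edges q + edges q) (begin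
        14                                                         ≡⟨ trans (handshake p) (cong₂ _+_ edges≡7 edges≡7) ⟨
        sum (innerDegree p)                                        ≤⟨ ∑innerDegree-─ p w ⟩
        sum (innerDegree q) + innerDegree p w + innerDegree p w    ≤⟨ +-mono-≤ (+-monoʳ-≤ _ (proj₂ low)) (proj₂ low) ⟩
        sum (innerDegree q) + 2 + 2                                ≡⟨ +-assoc _ 2 2 ⟩
        sum (innerDegree q) + 4                                    ≡⟨ cong (_+ 4) (handshake q) ⟩
        edges q + edges q + 4                                      ∎))
        where open ≤-Reasoning
      edges-q≤6 : edges q ≤ 6
      edges-q≤6 = +-double-cancel-≤ (subst (λ c → edges q + edges q ≤ 3 * c) card-q≡4 (edges+edges≤3card q))
      edges-q≡5 : edges q ≡ 5
      edges-q≡5 = ≤-antisym (≤-pred (≤∧≢⇒< edges-q≤6 (noK4 ∘ K4-component q card-q≡4))) 5≤edges-q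

-- Parts denser than a quarter of their size

Exceptional : ℕ → ℕ → Set
Exceptional s e = (s ≡ 3 × e ≡ 3) ⊎ (s ≡ 4 × e ≡ 5) ⊎ (s ≡ 5 × e ≡ 7)

exceptional? : ∀ s e → Dec (Exceptional s e)
exceptional? s e = (s ≟ℕ 3 ×-dec e ≟ℕ 3) ⊎-dec (s ≟ℕ 4 ×-dec e ≟ℕ 5) ⊎-dec (s ≟ℕ 5 ×-dec e ≟ℕ 7)

exceptional⇒4e≤s²+s : ∀ {s e} → Exceptional s e → 4 * e ≤ s * s + s
exceptional⇒4e≤s²+s (inj₁ (refl , refl))        = ≤ᵇ⇒≤ 12 12 tt
exceptional⇒4e≤s²+s (inj₂ (inj₁ (refl , refl))) = ≤ᵇ⇒≤ 20 20 tt
exceptional⇒4e≤s²+s (inj₂ (inj₂ (refl , refl))) = ≤ᵇ⇒≤ 28 30 tt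

DenseSpec : ℕ → ℕ → Set
DenseSpec s e = e + e ≤ 3 * s → e + e + s ≤ s * s → (s ≡ 4 → e ≢ 6) → s * s < 4 * e → Exceptional s e

denseSpec? : ∀ s e → Dec (DenseSpec s e)
denseSpec? s e =
  e + e ≤? 3 * s →-dec e + e + s ≤? s * s →-dec (s ≟ℕ 4 →-dec ¬? (e ≟ℕ 6)) →-dec s * s <? 4 * e →-dec exceptional? s e

-- Parts of at most five vertices, hence at most seven edges, are settled by evaluation.
denseSpec-small : ∀ (s : Fin 6) (e : Fin 8) → DenseSpec (toℕ s) (toℕ e)
denseSpec-small = toWitness {a? = all? λ s → all? λ e → denseSpec? (toℕ s) (toℕ e)} tt

dense⇒exceptional : ∀ s e → DenseSpec s e
dense⇒exceptional s e 2e≤3s 2e+s≤s² s≡4⇒e≢6 s²<4e with s <? 6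
... | yes s<6 = subst₂ DenseSpec (toℕ-fromℕ< s<6) (toℕ-fromℕ< e<8)
  (denseSpec-small (fromℕ< s<6) (fromℕ< e<8)) 2e≤3s 2e+s≤s² s≡4⇒e≢6 s²<4e
  where
  e<8 : e < 8
  e<8 = ≰⇒> λ 8≤e → ≤⇒≤ᵇ (≤-trans (+-mono-≤ 8≤e 8≤e) (≤-trans 2e≤3s (*-monoʳ-≤ 3 (≤-pred s<6))))
... | no  s≮6 = ⊥-elim (<⇒≱ s²<4e (begin
  4 * e              ≡⟨ solve 1 (λ e → con 4 :* e := (e :+ e) :+ (e :+ e)) refl e ⟩
  (e + e) + (e + e)  ≤⟨ +-mono-≤ 2e≤3s 2e≤3s ⟩
  3 * s + 3 * s      ≡⟨ *-distribʳ-+ s 3 3 ⟨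
  6 * s              ≤⟨ *-monoˡ-≤ s (≮⇒≥ s≮6) ⟩
  s * s              ∎))
  where
  open ≤-Reasoning
  open +-*-Solver

-- Witnesses for dense parts

⊆ᵇ⇒⊆ : ∀ {n} (S S' : VSet n) → T (S ⊆ᵇ S') → ∀ v → lookup S v ≡ true → lookup S' v ≡ true
⊆ᵇ⇒⊆ {n} S S' S⊆S' v Sv with lookup S' v in S'v
... | true  = refl
... | false = ⊥-elim (subst T (Equivalence.to T-not-≡ S⊆S') ⊇-fails)
  where
  outside : T (lookup S v ∧ not (lookup S' v))
  outside rewrite Sv | S'v = tt
  ⊇-fails : T (any (λ u → lookup S u ∧ not (lookup S' u)) (allFin n))
  ⊇-fails = any⁺ _ (Any.map (λ { refl → outside }) (∈-allFin v))

∈-allSubsets : ∀ {n} (S : VSet n) → S ∈ allSubsets n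
∈-allSubsets []           = here refl
∈-allSubsets (false ∷ᵛ S) = ∈-++⁺ˡ (∈-map⁺ (false ∷ᵛ_) (∈-allSubsets S))
∈-allSubsets {suc n} (true ∷ᵛ S) = ∈-++⁺ʳ (map (false ∷ᵛ_) (allSubsets n)) (∈-map⁺ (true ∷ᵛ_) (∈-allSubsets S))

-- d(S) > |S|/4
dense : ∀ {n} → Graph n → VSet n → Bool
dense G S = ⌊ size S * size S <? 4 * edgesIn G S ⌋

good : ∀ {n} → Graph n → VSet n → Bool
good G W = isDiamond G W ∨ isFreeTriangle G W

witnesses : ∀ {n} → Graph n → VSet n → VSet n → Bool
witnesses G S W = good G W ∧ (3 ≤ᵇ card (lookup W ∩ lookup S))

module _ {n : ℕ} (G : Graph n) where

  isDiamond-intro : ∀ W → size W ≡ 4 → edgesIn G W ≡ 5 → isDiamond G W ≡ true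
  isDiamond-intro W s≡4 e≡5 rewrite s≡4 | e≡5 = refl

  isTriangle-intro : ∀ W → size W ≡ 3 → edgesIn G W ≡ 3 → isTriangle G W ≡ true
  isTriangle-intro W s≡3 e≡3 rewrite s≡3 | e≡3 = refl

  diamond⇒good : ∀ W → isDiamond G W ≡ true → good G W ≡ true
  diamond⇒good W d rewrite d = refl

  witnesses-intro : ∀ S W → good G W ≡ true → 3 ≤ card (lookup W ∩ lookup S) → witnesses G S W ≡ true
  witnesses-intro S W g 3≤ rewrite g = Equivalence.to T-≡ (≤⇒≤ᵇ 3≤)

  ⊆-witnesses : ∀ S W → good G W ≡ true → (∀ v → lookup S v ≡ true → lookup W v ≡ true) → 3 ≤ size S →
    witnesses G S W ≡ true
  ⊆-witnesses S W g S⊆W 3≤s = witnesses-intro S W g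
    (≤-trans 3≤s (≤-reflexive (trans (size≡card S) (sym (⊆⇒card-∩ (lookup S) (lookup W) S⊆W)))))

  ⊇-witnesses : ∀ S W → good G W ≡ true → (∀ v → lookup W v ≡ true → lookup S v ≡ true) → 3 ≤ size W →
    witnesses G S W ≡ true
  ⊇-witnesses S W g W⊆S 3≤w = witnesses-intro S W g (≤-trans 3≤w (≤-reflexive (begin
    size W                        ≡⟨ size≡card W ⟩
    card (lookup W)               ≡⟨ ⊆⇒card-∩ (lookup W) (lookup S) W⊆S ⟨
    card (lookup S ∩ lookup W)    ≡⟨ card-∩-comm (lookup S) (lookup W) ⟩
    card (lookup W ∩ lookup S)    ∎)))
    where open ≡-Reasoning

  good⇒size≤4 : ∀ W → good G W ≡ true → size W ≤ 4
  good⇒size≤4 W g with size W ≡ᵇ 4 in s≡4 | size W ≡ᵇ 3 in s≡3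
  ... | true | _    = ≤-reflexive (≡ᵇ⇒≡ (size W) 4 (Equivalence.from T-≡ s≡4))
  ... | false | true = ≤-trans (≤-reflexive (≡ᵇ⇒≡ (size W) 3 (Equivalence.from T-≡ s≡3))) (n≤1+n 3)
  ... | false | false with g
  ... | ()

  module _ (cubic : Cubic G) (noK4 : ¬ HasK4Component G) where

    dense-part⇒exceptional : ∀ S → size S * size S < 4 * edgesIn G S → Exceptional (size S) (edgesIn G S)
    dense-part⇒exceptional S = dense⇒exceptional (size S) (edgesIn G S) 2e≤3s 2e+s≤s² s≡4⇒e≢6
      where
      p = lookup S
      2e≤3s : edgesIn G S + edgesIn G S ≤ 3 * size S
      2e≤3s = subst₂ (λ e s → e + e ≤ 3 * s) (sym (edgesIn≡edges G S)) (sym (size≡card S))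
        (edges+edges≤3card G cubic p)
      2e+s≤s² : edgesIn G S + edgesIn G S + size S ≤ size S * size S
      2e+s≤s² = subst₂ (λ e s → e + e + s ≤ s * s) (sym (edgesIn≡edges G S)) (sym (size≡card S))
        (edges+edges+card≤card² G p)
      s≡4⇒e≢6 : size S ≡ 4 → edgesIn G S ≢ 6
      s≡4⇒e≢6 s≡4 e≡6 = noK4 (K4-component G cubic p
        (trans (sym (size≡card S)) s≡4) (trans (sym (edgesIn≡edges G S)) e≡6))

    4*edgesIn≤size²+size*χdense : ∀ S → 4 * edgesIn G S ≤ size S * size S + size S * χ (dense G S)
    4*edgesIn≤size²+size*χdense S with size S * size S <? 4 * edgesIn G S
    ... | yes s²<4e = ≤-trans (exceptional⇒4e≤s²+s (dense-part⇒exceptional S s²<4e))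
                        (≤-reflexive (cong (size S * size S +_) (sym (*-identityʳ (size S)))))
    ... | no  s²≮4e = ≤-trans (≮⇒≥ s²≮4e) (m≤m+n _ _)

    exceptional⇒witness : ∀ S → Exceptional (size S) (edgesIn G S) → ∃[ W ] witnesses G S W ≡ true
    exceptional⇒witness S (inj₁ (s≡3 , e≡3)) with isFreeTriangle G S in free
    ... | true  = S , ⊆-witnesses S S (trans (cong (isDiamond G S ∨_) free) (∨-zeroʳ _)) (λ _ → id) (≤-reflexive (sym s≡3))
    ... | false = S' , ⊆-witnesses S S' (diamond⇒good S' S'-diamond) (⊆ᵇ⇒⊆ S S' (proj₁ S⊆S'∧diamond))
                         (≤-reflexive (sym s≡3))
      where
      in-diamond : any (λ S' → (S ⊆ᵇ S') ∧ isDiamond G S') (allSubsets n) ≡ true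
      in-diamond = ∧-not≡false⇒ (isTriangle-intro S s≡3 e≡3) free
      found = Any.satisfied (any⁻ _ (allSubsets n) (Equivalence.from T-≡ in-diamond))
      S' = proj₁ found
      S⊆S'∧diamond : T (S ⊆ᵇ S') × T (isDiamond G S')
      S⊆S'∧diamond = Equivalence.to T-∧ (proj₂ found)
      S'-diamond = Equivalence.to T-≡ (proj₂ S⊆S'∧diamond)
    exceptional⇒witness S (inj₂ (inj₁ (s≡4 , e≡5))) =
      S , ⊆-witnesses S S (diamond⇒good S (isDiamond-intro S s≡4 e≡5)) (λ _ → id)
            (≤-trans (n≤1+n 3) (≤-reflexive (sym s≡4)))
    exceptional⇒witness S (inj₂ (inj₂ (s≡5 , e≡7))) =
      W , ⊇-witnesses S W (diamond⇒good W (isDiamond-intro W size-W≡4 edgesIn-W≡5)) W⊆S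
            (≤-trans (n≤1+n 3) (≤-reflexive (sym size-W≡4)))
      where
      found = card≡5∧edges≡7⇒diamond G cubic noK4 (lookup S)
        (trans (sym (size≡card S)) s≡5) (trans (sym (edgesIn≡edges G S)) e≡7)
      w = proj₁ found
      q = lookup S ─ w
      W = tabulateᵛ q
      lookup-W : ∀ v → lookup W v ≡ q v
      lookup-W = lookup∘tabulate q
      W⊆S : ∀ v → lookup W v ≡ true → lookup S v ≡ true
      W⊆S v Wv = proj₁ (─-member (lookup S) w v (trans (sym (lookup-W v)) Wv))
      size-W≡4 : size W ≡ 4
      size-W≡4 = trans (size≡card W) (trans (card-cong lookup-W) (proj₁ (proj₂ (proj₂ found))))
      edgesIn-W≡5 : edgesIn G W ≡ 5
      edgesIn-W≡5 = trans (edgesIn≡edges G W) (trans (edges-cong G lookup-W) (proj₂ (proj₂ (proj₂ found))))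

    dense⇒witness : ∀ S → dense G S ≡ true → ∃[ W ] witnesses G S W ≡ true
    dense⇒witness S d with size S * size S <? 4 * edgesIn G S
    dense⇒witness S d  | yes s²<4e = exceptional⇒witness S (dense-part⇒exceptional S s²<4e)
    dense⇒witness S () | no  _

module _ {n : ℕ} (P : Partition n) where

  lookup-part : ∀ i v → lookup (part P i) v ≡ ⌊ label P v ≟ i ⌋
  lookup-part i = lookup∘tabulate (λ v → ⌊ label P v ≟ i ⌋)

  ∑size-parts : sum (λ i → size (part P i)) ≡ n
  ∑size-parts = begin
    sum (λ i → size (part P i))                     ≡⟨ sum-cong-≗ {k P} (λ i → trans (size≡card (part P i)) (card-cong (lookup-part i))) ⟩
    sum (λ i → sum λ v → χ ⌊ label P v ≟ i ⌋)       ≡⟨ ∑-comm {k P} {n} _ ⟩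
    sum (λ v → sum λ i → χ ⌊ label P v ≟ i ⌋)       ≡⟨ sum-cong-≗ {n} (λ v → sum-cong-≗ {k P} (λ i →
                                                         trans (cong χ (≟-sym (label P v) i)) (sym (*-identityʳ _)))) ⟩
    sum (λ v → sum λ i → χ ⌊ i ≟ label P v ⌋ * 1)   ≡⟨ sum-cong-≗ {n} (λ v → ∑-pick (label P v) (λ _ → 1)) ⟩
    sum {n} (λ _ → 1)                               ≡⟨ ∑-1 n ⟩
    n                                               ∎
    where open ≡-Reasoning

  parts-disjoint : ∀ i j → i ≢ j → ∀ v → lookup (part P i) v ≡ true → lookup (part P j) v ≡ true → ⊥
  parts-disjoint i j i≢j v vᵢ vⱼ with label P v ≟ i | label P v ≟ j | lookup-part i v | lookup-part j v
  ... | yes refl | yes refl | _ | _ = i≢j refl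
  ... | no _     | _        | e | _ = case trans (sym vᵢ) e of λ ()
  ... | yes _    | no _     | _ | e = case trans (sym vⱼ) e of λ ()

  module _ (G : Graph n) (cubic : Cubic G) (noK4 : ¬ HasK4Component G) where

    ∑χdense≤numDiamonds+numFreeTriangles : sum (λ i → χ (dense G (part P i))) ≤ numDiamonds G + numFreeTriangles G
    ∑χdense≤numDiamonds+numFreeTriangles = begin
      sum (λ i → χ (dense G (part P i)))
        ≤⟨ ∑χ-≤-witnesses (allSubsets n) (dense G ∘ part P) (good G) (witnesses G ∘ part P) has-witness
             (λ W i → ∧≡true⇒ˡ) unique-witness ⟩
      sumᴸ (map (χ ∘ good G) (allSubsets n))
        ≤⟨ sumᴸ-mono-≤ (allSubsets n) (λ W → χ-∨-≤ (isDiamond G W) (isFreeTriangle G W)) ⟩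
      sumᴸ (map (λ W → χ (isDiamond G W) + χ (isFreeTriangle G W)) (allSubsets n))
        ≡⟨ sumᴸ-distrib-+ (allSubsets n) _ _ ⟩
      sumᴸ (map (χ ∘ isDiamond G) (allSubsets n)) + sumᴸ (map (χ ∘ isFreeTriangle G) (allSubsets n))
        ≡⟨ cong₂ _+_ (length-filter≡sumᴸχ (isDiamond G) (allSubsets n)) (length-filter≡sumᴸχ (isFreeTriangle G) (allSubsets n)) ⟨
      numDiamonds G + numFreeTriangles G ∎
      where
      open ≤-Reasoning
      has-witness : ∀ i → dense G (part P i) ≡ true → ∃[ W ] W ∈ allSubsets n × witnesses G (part P i) W ≡ true
      has-witness i d = let W , w = dense⇒witness G cubic noK4 (part P i) d in W , ∈-allSubsets W , w
      unique-witness : ∀ W i j → witnesses G (part P i) W ≡ true → witnesses G (part P j) W ≡ true → i ≡ j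
      unique-witness W i j wᵢ wⱼ with i ≟ j
      ... | yes i≡j = i≡j
      ... | no  i≢j = ⊥-elim (≤⇒≤ᵇ (begin
        3 + 3                                                             ≤⟨ +-mono-≤ (shared (part P i) wᵢ) (shared (part P j) wⱼ) ⟩
        card (lookup W ∩ lookup (part P i)) + card (lookup W ∩ lookup (part P j))
                                                                          ≤⟨ card-∩-disjoint _ _ _ (parts-disjoint i j i≢j) ⟩
        card (lookup W)                                                   ≡⟨ size≡card W ⟨
        size W                                                            ≤⟨ good⇒size≤4 G W (∧≡true⇒ˡ wᵢ) ⟩
        4                                                                 ∎))
        where
        shared : ∀ S → witnesses G S W ≡ true → 3 ≤ card (lookup W ∩ lookup S)
        shared S w = ≤ᵇ⇒≤ 3 _ (Equivalence.from T-≡ (∧≡true⇒ʳ w))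

module _ where

  open import Data.Integer using (+_)

  ¼ : ℚ
  ¼ = + 1 / 4

  toℚᵘ-ℕtoℚ : ∀ x → ℚ.toℚᵘ (ℕtoℚ x) ≡ ℚᵘ.mkℚᵘ (+ x) 0
  toℚᵘ-ℕtoℚ x = cong ℚ.toℚᵘ (ℚᴾ.normalize-coprime (Coprimality.sym (Coprimality.1-coprimeTo x)))

  ℕtoℚ-+ : ∀ a b → ℕtoℚ (a + b) ≡ ℕtoℚ a ℚ.+ ℕtoℚ b
  ℕtoℚ-+ a b = ℚᴾ.toℚᵘ-injective (begin
    ℚ.toℚᵘ (ℕtoℚ (a + b))                               ≡⟨ toℚᵘ-ℕtoℚ (a + b) ⟩
    ℚᵘ.mkℚᵘ (+ (a + b)) 0                               ≈⟨ ℚᵘ.*≡* sum≡ ⟩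
    ℚᵘ.mkℚᵘ (+ a) 0 ℚᵘ.+ ℚᵘ.mkℚᵘ (+ b) 0                 ≡⟨ cong₂ ℚᵘ._+_ (toℚᵘ-ℕtoℚ a) (toℚᵘ-ℕtoℚ b) ⟨
    ℚ.toℚᵘ (ℕtoℚ a) ℚᵘ.+ ℚ.toℚᵘ (ℕtoℚ b)                 ≈⟨ ℚᴾ.toℚᵘ-homo-+ (ℕtoℚ a) (ℕtoℚ b) ⟨
    ℚ.toℚᵘ (ℕtoℚ a ℚ.+ ℕtoℚ b)                          ∎)
    where
    open ℚᵘᴾ.≃-Reasoning
    sum≡ : + (a + b) ℤ.* + 1 ≡ (+ a ℤ.* + 1 ℤ.+ + b ℤ.* + 1) ℤ.* + 1
    sum≡ = trans (ℤᴾ.*-identityʳ _) (trans (ℤᴾ.pos-+ a b) (sym (trans (ℤᴾ.*-identityʳ _)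
             (cong₂ ℤ._+_ (ℤᴾ.*-identityʳ (+ a)) (ℤᴾ.*-identityʳ (+ b))))))

  ℕtoℚ-mono-≤ : ∀ {a b} → a ≤ b → ℕtoℚ a ℚ.≤ ℕtoℚ b
  ℕtoℚ-mono-≤ {a} {b} a≤b = ℚᴾ.toℚᵘ-cancel-≤
    (subst₂ ℚᵘ._≤_ (sym (toℚᵘ-ℕtoℚ a)) (sym (toℚᵘ-ℕtoℚ b)) (ℚᵘ.*≤* (ℤᴾ.*-monoʳ-≤-nonNeg (+ 1) (ℤ.+≤+ a≤b))))

  /≤¼* : ∀ e m x → e * 4 ≤ x * suc m → (+ e) / suc m ℚ.≤ ¼ ℚ.* ℕtoℚ x
  /≤¼* e m x 4e≤xs = ℚᴾ.toℚᵘ-cancel-≤ (begin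
    ℚ.toℚᵘ ((+ e) / suc m)              ≃⟨ ℚᴾ.toℚᵘ-fromℚᵘ (ℚᵘ.mkℚᵘ (+ e) m) ⟩
    ℚᵘ.mkℚᵘ (+ e) m                     ≤⟨ ℚᵘ.*≤* cross-multiplied ⟩
    ℚᵘ.mkℚᵘ (+ 1) 3 ℚᵘ.* ℚᵘ.mkℚᵘ (+ x) 0 ≡⟨ cong (ℚᵘ.mkℚᵘ (+ 1) 3 ℚᵘ.*_) (toℚᵘ-ℕtoℚ x) ⟨
    ℚ.toℚᵘ ¼ ℚᵘ.* ℚ.toℚᵘ (ℕtoℚ x)        ≃⟨ ℚᴾ.toℚᵘ-homo-* ¼ (ℕtoℚ x) ⟨
    ℚ.toℚᵘ (¼ ℚ.* ℕtoℚ x)               ∎)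
    where
    open ℚᵘᴾ.≤-Reasoning
    cross-multiplied : + e ℤ.* + 4 ℤ.≤ (+ 1 ℤ.* + x) ℤ.* + suc m
    cross-multiplied = subst₂ ℤ._≤_ (ℤᴾ.pos-* e 4)
      (trans (ℤᴾ.pos-* x (suc m)) (cong (ℤ._* + suc m) (sym (ℤᴾ.*-identityˡ (+ x))))) (ℤ.+≤+ 4e≤xs)

  density≤¼ : ∀ {n} (G : Graph n) S x → 4 * edgesIn G S ≤ size S * x → density G S ℚ.≤ ¼ ℚ.* ℕtoℚ x
  density≤¼ G S x 4e≤sx with size S
  ... | zero  = /≤¼* 0 0 x z≤n
  ... | suc m = /≤¼* (edgesIn G S) m x (subst₂ _≤_ (*-comm 4 (edgesIn G S)) (*-comm (suc m) x) 4e≤sx)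

  sumℚ≤¼* : ∀ {A : Set} (xs : List A) (f : A → ℚ) (g : A → ℕ) → (∀ x → f x ℚ.≤ ¼ ℚ.* ℕtoℚ (g x)) →
    sumℚ (map f xs) ℚ.≤ ¼ ℚ.* ℕtoℚ (sumᴸ (map g xs))
  sumℚ≤¼* []       f g f≤ = ℚᴾ.≤-reflexive (sym (ℚᴾ.*-zeroʳ ¼))
  sumℚ≤¼* (x ∷ xs) f g f≤ = ℚᴾ.≤-trans (ℚᴾ.+-mono-≤ (f≤ x) (sumℚ≤¼* xs f g f≤)) (ℚᴾ.≤-reflexive (begin
    ¼ ℚ.* ℕtoℚ (g x) ℚ.+ ¼ ℚ.* ℕtoℚ (sumᴸ (map g xs))  ≡⟨ ℚᴾ.*-distribˡ-+ ¼ (ℕtoℚ (g x)) (ℕtoℚ (sumᴸ (map g xs))) ⟨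
    ¼ ℚ.* (ℕtoℚ (g x) ℚ.+ ℕtoℚ (sumᴸ (map g xs)))      ≡⟨ cong (¼ ℚ.*_) (ℕtoℚ-+ (g x) (sumᴸ (map g xs))) ⟨
    ¼ ℚ.* ℕtoℚ (g x + sumᴸ (map g xs))                 ∎))
    where open ≡-Reasoning

  ¼-rearrange : ∀ x d t → ¼ ℚ.* (x ℚ.+ (d ℚ.+ t)) ≡
    ((+ 5) / 4) ℚ.* d ℚ.+ t ℚ.+ ((+ 1) / 4) ℚ.* (x ℚ.- (ℕtoℚ 3 ℚ.* t) ℚ.- (ℕtoℚ 4 ℚ.* d))
  ¼-rearrange = solve 3 (λ x d t → con ¼ :* (x :+ (d :+ t)) :=
    con ((+ 5) / 4) :* d :+ t :+ con ¼ :* (x :- con (ℕtoℚ 3) :* t :- con (ℕtoℚ 4) :* d)) refl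
    where open ℚ-Solver.+-*-Solver

  partDensity≤¼*[n+#dense] : ∀ {n} (G : Graph n) → Cubic G → ¬ HasK4Component G → (P : Partition n) →
    partDensity G P ℚ.≤ ¼ ℚ.* ℕtoℚ (n + sum (λ i → χ (dense G (part P i))))
  partDensity≤¼*[n+#dense] {n} G cubic noK4 P = ℚᴾ.≤-trans
    (sumℚ≤¼* (allFin (k P)) _ bound part-density≤)
    (ℚᴾ.≤-reflexive (cong (λ m → ¼ ℚ.* ℕtoℚ m) ∑bound))
    where
    #dense = sum (λ i → χ (dense G (part P i)))
    bound : Fin (k P) → ℕ
    bound i = size (part P i) + χ (dense G (part P i))
    part-density≤ : ∀ i → density G (part P i) ℚ.≤ ¼ ℚ.* ℕtoℚ (bound i)
    part-density≤ i = density≤¼ G (part P i) (bound i)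
      (subst (4 * edgesIn G (part P i) ≤_) (sym (*-distribˡ-+ (size (part P i)) _ _))
        (4*edgesIn≤size²+size*χdense G cubic noK4 (part P i)))
    ∑bound : sumᴸ (map bound (allFin (k P))) ≡ n + #dense
    ∑bound = trans (sumᴸ-allFin bound) (trans (∑-distrib-+ {k P} _ _) (cong (_+ #dense) (∑size-parts P)))

  lemma10 : (n : ℕ) (G : Graph n) → Cubic G → ¬ HasK4Component G →
    (P : Partition n) →
    partDensity G P ℚ.≤
      ((+ 5) / 4) ℚ.* ℕtoℚ (numDiamonds G) ℚ.+ ℕtoℚ (numFreeTriangles G)
      ℚ.+ ((+ 1) / 4) ℚ.* (ℕtoℚ n ℚ.- (ℕtoℚ 3 ℚ.* ℕtoℚ (numFreeTriangles G)) ℚ.- (ℕtoℚ 4 ℚ.* ℕtoℚ (numDiamonds G)))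
  lemma10 n G cubic noK4 P = begin
    partDensity G P                             ≤⟨ partDensity≤¼*[n+#dense] G cubic noK4 P ⟩
    ¼ ℚ.* ℕtoℚ (n + #dense)                     ≤⟨ ℚᴾ.*-monoˡ-≤-nonNeg ¼ (ℕtoℚ-mono-≤ (+-monoʳ-≤ n #dense≤#D+#T)) ⟩
    ¼ ℚ.* ℕtoℚ (n + (#D + #T))                  ≡⟨ cong (¼ ℚ.*_) (trans (ℕtoℚ-+ n _) (cong (ℕtoℚ n ℚ.+_) (ℕtoℚ-+ #D #T))) ⟩
    ¼ ℚ.* (ℕtoℚ n ℚ.+ (ℕtoℚ #D ℚ.+ ℕtoℚ #T))    ≡⟨ ¼-rearrange (ℕtoℚ n) (ℕtoℚ #D) (ℕtoℚ #T) ⟩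
    _                                           ∎
    where
    open ℚᴾ.≤-Reasoning
    #D = numDiamonds G
    #T = numFreeTriangles G
    #dense = sum (λ i → χ (dense G (part P i)))
    #dense≤#D+#T : #dense ≤ #D + #T
    #dense≤#D+#T = ∑χdense≤numDiamonds+numFreeTriangles P G cubic noK4
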